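{- Let $\mathbf{s}=(n,n-1,\dots,2,1)$. Then $\operatorname{REM}_{\mathbf{s}}$ is a bijection between $\operatorname{Par}_{\mathbf{s}}\cap\mathbb{Z}^n$ and the set $\langle n-1\rangle\times\cdots\times\langle 0\rangle$ of inversion sequences of length $n$, and its inverse is \[\mathbf{r}=(r_1,\dots,r_n)\mapsto\big(\operatorname{des}^{<1}(\mathbf{r})s_1+r_1,\dots,\operatorname{des}^{<n}(\mathbf{r})s_n+r_n\big).\]
   Context: $\langle N\rangle=\{0,\dots,N\}$; here $s_i=n+1-i$. $\operatorname{Par}_{\mathbf{s}}=\{\sum_{j=1}^n c_j\mathbf{w}_j:0\le c_j<1\}$ with $\mathbf{w}_j=(0,\dots,0,s_j,\dots,s_n)$ ($j-1$ leading zeros). $\operatorname{REM}_{\mathbf{s}}$ maps $\mathbf{x}\in\operatorname{Par}_{\mathbf{s}}\cap\mathbb{Z}^n$ to the vector of remainders of $x_i$ modulo $s_i$. $\operatorname{des}^{<i}(\mathbf{r})=\#\{j<i: r_j>r_{j+1}\}$. -}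

module Defs where

open import Data.Nat using (ℕ; zero; suc; _+_; _*_; _<_; _<?_)
open import Data.Fin using (Fin; zero; suc; toℕ; opposite; _≤?_)
open import Data.Integer using (ℤ; +_)
open import Data.Integer.DivMod using (_%ℕ_)
open import Data.Rational using (ℚ; 0ℚ; 1ℚ) renaming (_+_ to _+ℚ_; _*_ to _*ℚ_; _≤_ to _≤ℚ_; _<_ to _<ℚ_; _/_ to _/ℚ_)
open import Data.Product using (Σ; _×_)
open import Data.Bool using (if_then_else_)
open import Relation.Nullary using (does)
open import Relation.Binary.PropositionalEquality using (_≡_)
open import Function using (_∘_)

-- s_i = n + 1 - i (1-based); for a 0-based index i : Fin n this is n - toℕ i
-- = suc (toℕ (opposite i)), which is syntactically nonzero.
s : {n : ℕ} → Fin n → ℕ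
s i = suc (toℕ (opposite i))

-- i-th coordinate of w_j = (0,…,0,s_j,…,s_n) (j-1 leading zeros, 1-based):
-- s_i if j ≤ i, else 0.
w : {n : ℕ} → Fin n → Fin n → ℕ
w j i = if does (j ≤? i) then s i else 0

sumℚ : {n : ℕ} → (Fin n → ℚ) → ℚ
sumℚ {zero}  f = 0ℚ
sumℚ {suc n} f = f zero +ℚ sumℚ (f ∘ suc)

toℚ : ℤ → ℚ
toℚ z = z /ℚ 1

InPar : {n : ℕ} → (Fin n → ℤ) → Set
InPar {n} x = Σ (Fin n → ℚ) λ c →
  ((j : Fin n) → (0ℚ ≤ℚ c j) × (c j <ℚ 1ℚ)) ×
  ((i : Fin n) → toℚ (x i) ≡ sumℚ (λ j → c j *ℚ toℚ (+ w j i)))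

REM : {n : ℕ} → (Fin n → ℤ) → (Fin n → ℕ)
REM x i = x i %ℕ s i

-- inversion sequences of length n: r ∈ ⟨n-1⟩ × ⋯ × ⟨0⟩, i.e. r_i < s_i
IsInvSeq : {n : ℕ} → (Fin n → ℕ) → Set
IsInvSeq r = ∀ i → r i < s i

-- des^{<i}(r) = #{ j < i : r_j > r_{j+1} } (1-based i, j);
-- 0-based: desBefore r i counts k with k + 1 ≤ toℕ i and r_k > r_{k+1}.
desBefore : {n : ℕ} → (Fin n → ℕ) → Fin n → ℕ
desBefore r zero = 0
desBefore {suc (suc m)} r (suc i) =
  (if does (r (suc zero) <? r zero) then 1 else 0) + desBefore (r ∘ suc) i

invREM : {n : ℕ} → (Fin n → ℕ) → (Fin n → ℤ)
invREM r i = + (desBefore r i * s i + r i)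

module Submission where

open import Defs
open import Data.Nat using (ℕ)
open import Data.Fin using (Fin)
open import Data.Integer using (ℤ)
open import Data.Product using (_×_)
open import Relation.Binary.PropositionalEquality using (_≡_)

-- The i-th coordinate of Σ_j c_j w_j is C_i·s_i with C_i = c_0 + ⋯ + c_i, so
-- x ∈ Par_s iff the quotients C_i = x_i/s_i satisfy 0 ≤ C_0 < 1 and
-- C_i ≤ C_{i+1} < C_i + 1.  For integral x this forces x_i ∈ ℕ, and the
-- conditions become inequalities between natural numbers.  Write
-- x_i = Q_i·s_i + r_i with r = REM x.  Since s_i = s_{i+1} + 1, the condition
-- between i and i+1 is a carry in base s_i·s_{i+1}: it holds iff
-- Q_{i+1} = Q_i + [r_i > r_{i+1}].  Summing, all conditions hold iff
-- Q_i = Q_0 + des^{<i}(r), while 0 ≤ C_0 < 1 says Q_0 = 0.  Both inverse laws follow.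

module Carries where

  open import Data.Nat using (ℕ; zero; suc; _+_; _*_; _≤_; _<_; _<?_)
  open import Data.Nat.Properties
  open import Data.Nat.Tactic.RingSolver using (solve-∀)
  open import Data.Fin using (Fin; zero; suc; inject₁)
  open import Data.Bool using (if_then_else_)
  open import Data.Product using (_×_; _,_)
  open import Data.Sum using (inj₁; inj₂)
  open import Function using (_∘_; _⇔_; mk⇔; Equivalence)
  open import Relation.Nullary using (does; yes; no; ¬_; contradiction)
  open import Relation.Nullary.Decidable using (dec-true; dec-false)
  open import Relation.Binary.PropositionalEquality

  descent : ℕ → ℕ → ℕ
  descent a b = if does (b <? a) then 1 else 0

  descent-yes : ∀ {a b} → b < a → descent a b ≡ 1
  descent-yes {a} {b} b<a = cong (λ t → if t then 1 else 0) (dec-true (b <? a) b<a)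

  descent-no : ∀ {a b} → ¬ b < a → descent a b ≡ 0
  descent-no {a} {b} b≮a = cong (λ t → if t then 1 else 0) (dec-false (b <? a) b≮a)

  descent-cong : ∀ {a b a′ b′} → (b < a ⇔ b′ < a′) → descent a b ≡ descent a′ b′
  descent-cong {a} {b} {a′} {b′} b<a⇔ with b <? a
  ... | yes b<a = trans (descent-yes b<a) (sym (descent-yes (Equivalence.to b<a⇔ b<a)))
  ... | no b≮a  = trans (descent-no b≮a) (sym (descent-no (b≮a ∘ Equivalence.from b<a⇔)))

  desBefore-step : ∀ {m} (r : Fin (suc m) → ℕ) (i : Fin m) →
    desBefore r (suc i) ≡ desBefore r (inject₁ i) + descent (r (inject₁ i)) (r (suc i))
  desBefore-step r zero = +-identityʳ _
  desBefore-step {suc m} r (suc i) = begin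
    d + desBefore (r ∘ suc) (suc i)
      ≡⟨ cong (d +_) (desBefore-step (r ∘ suc) i) ⟩
    d + (desBefore (r ∘ suc) (inject₁ i) + descent (r (suc (inject₁ i))) (r (suc (suc i))))
      ≡⟨ +-assoc d _ _ ⟨
    (d + desBefore (r ∘ suc) (inject₁ i)) + descent (r (suc (inject₁ i))) (r (suc (suc i))) ∎
    where
    open ≡-Reasoning
    d : ℕ
    d = descent (r zero) (r (suc zero))

  leading-digit-≤ : ∀ {a b u v P} → v < P → a * P + u ≤ b * P + v → a ≤ b
  leading-digit-≤ {a} {b} {u} {v} {P} v<P h = m<1+n⇒m≤n (*-cancelʳ-< P a (suc b) (begin-strict
    a * P      ≤⟨ m≤m+n (a * P) u ⟩
    a * P + u  ≤⟨ h ⟩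
    b * P + v  <⟨ +-monoʳ-< (b * P) v<P ⟩
    b * P + P  ≡⟨ +-comm (b * P) P ⟩
    suc b * P  ∎))
    where open ≤-Reasoning

  CarryWindow : ℕ → ℕ → ℕ → ℕ → ℕ → Set
  CarryWindow P a u b v = (a * P + u ≤ b * P + v) × (b * P + v < suc a * P + u)

  carry⇒ : ∀ {a b u v P} → u < P → v < P → CarryWindow P a u b v → b ≡ a + descent u v
  carry⇒ {a} {b} {u} {v} {P} u<P v<P (lower , upper)
    with m≤n⇒m<n∨m≡n (leading-digit-≤ {a} {b} v<P lower)
  ... | inj₂ refl = sym (trans (cong (a +_) (descent-no v≮u)) (+-identityʳ a))
    where
    v≮u : ¬ v < u
    v≮u v<u = <⇒≱ v<u (+-cancelˡ-≤ (a * P) u v lower)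
  ... | inj₁ a<b = trans b≡1+a (trans (+-comm 1 a) (cong (a +_) (sym (descent-yes v<u))))
    where
    b≡1+a : b ≡ suc a
    b≡1+a = ≤-antisym (leading-digit-≤ u<P (<⇒≤ upper)) a<b
    v<u : v < u
    v<u = +-cancelˡ-< (suc a * P) v u (subst (λ c → c * P + v < suc a * P + u) b≡1+a upper)

  carry⇐ : ∀ {a b u v P} → u < P → v < P → b ≡ a + descent u v → CarryWindow P a u b v
  carry⇐ {a} {b} {u} {v} {P} u<P v<P b≡ with v <? u
  ... | yes v<u rewrite trans b≡ (trans (cong (a +_) (descent-yes v<u)) (+-comm a 1)) =
    ≤-trans (+-monoʳ-≤ (a * P) (<⇒≤ u<P)) (≤-trans (≤-reflexive (+-comm (a * P) P)) (m≤m+n (suc a * P) v)) ,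
    +-monoʳ-< (suc a * P) v<u
  ... | no v≮u rewrite trans b≡ (trans (cong (a +_) (descent-no v≮u)) (+-identityʳ a)) =
    +-monoʳ-≤ (a * P) (≮⇒≥ v≮u) ,
    <-≤-trans (+-monoʳ-< (a * P) v<P) (≤-trans (≤-reflexive (+-comm (a * P) P)) (m≤m+n (suc a * P) u))

  carry : ∀ {a b u v P} → u < P → v < P → CarryWindow P a u b v ⇔ (b ≡ a + descent u v)
  carry u<P v<P = mk⇔ (carry⇒ u<P v<P) (carry⇐ u<P v<P)

  -- FracStep X S Y T says  X/S ≤ Y/T < X/S + 1,  cleared of denominators.
  FracStep : ℕ → ℕ → ℕ → ℕ → Set
  FracStep X S Y T = (X * T ≤ Y * S) × (Y * S < (X + S) * T)

  -- For radices S = T + 1, digits r < S, r′ < T compare like their scaled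
  -- versions r·T and r′·S; this is what makes the step a carry in base S·T.
  scaled-descent : ∀ {r r′ T} → r < suc T → r′ < T → r′ * suc T < r * T ⇔ r′ < r
  scaled-descent {r} {r′} {T} r<S r′<T = mk⇔ to from
    where
    from : r′ < r → r′ * suc T < r * T
    from r′<r = begin-strict
      r′ * suc T   ≡⟨ *-suc r′ T ⟩
      r′ + r′ * T  <⟨ +-monoˡ-< (r′ * T) r′<T ⟩
      suc r′ * T   ≤⟨ *-monoˡ-≤ T r′<r ⟩
      r * T        ∎
      where open ≤-Reasoning
    to : r′ * suc T < r * T → r′ < r
    to h with r′ <? r
    ... | yes r′<r = r′<r
    ... | no r′≮r = contradiction h (≤⇒≯ (≤-trans (*-monoˡ-≤ T (≮⇒≥ r′≮r)) (*-monoʳ-≤ r′ (n≤1+n T))))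

  radix-step : ∀ {Q Q′ r r′ S T} → S ≡ suc T → r < S → r′ < T →
    FracStep (Q * S + r) S (Q′ * T + r′) T ⇔ (Q′ ≡ Q + descent r r′)
  radix-step {Q} {Q′} {r} {r′} {T = zero} _ _ ()
  radix-step {Q} {Q′} {r} {r′} {T = T@(suc _)} refl r<S r′<T = mk⇔
    (λ h → trans (Equivalence.to (carry u<P v<P) (subst (λ A → A) as-window h)) (cong (Q +_) same-descent))
    (λ e → subst (λ A → A) (sym as-window) (Equivalence.from (carry u<P v<P) (trans e (cong (Q +_) (sym same-descent)))))
    where
    S : ℕ
    S = suc T
    u<P : r * T < S * T
    u<P = *-monoˡ-< T r<S
    v<P : r′ * S < S * T
    v<P = subst (r′ * S <_) (*-comm T S) (*-monoˡ-< S r′<T)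
    same-descent : descent (r * T) (r′ * S) ≡ descent r r′
    same-descent = descent-cong (scaled-descent r<S r′<T)
    lhs : ∀ q r s t → (q * s + r) * t ≡ q * (s * t) + r * t
    lhs = solve-∀
    mid : ∀ q r s t → (q * t + r) * s ≡ q * (s * t) + r * s
    mid = solve-∀
    rhs : ∀ q r s t → (q * s + r + s) * t ≡ suc q * (s * t) + r * t
    rhs = solve-∀
    as-window : FracStep (Q * S + r) S (Q′ * T + r′) T ≡ CarryWindow (S * T) Q (r * T) Q′ (r′ * S)
    as-window = cong₂ _×_ (cong₂ _≤_ (lhs Q r S T) (mid Q′ r′ S T)) (cong₂ _<_ (mid Q′ r′ S T) (rhs Q r S T))

  Consecutive : ∀ {m} → (Fin (suc m) → Fin (suc m) → Set) → Set
  Consecutive {m} R = (i : Fin m) → R (inject₁ i) (suc i)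

  telescope : ∀ {m} (Q r : Fin (suc m) → ℕ) →
    Consecutive (λ i j → Q j ≡ Q i + descent (r i) (r j)) ⇔ (∀ i → Q i ≡ Q zero + desBefore r i)
  telescope Q r = mk⇔ (summed Q r) increments
    where
    summed : ∀ {m} (Q r : Fin (suc m) → ℕ) →
      Consecutive (λ i j → Q j ≡ Q i + descent (r i) (r j)) → ∀ i → Q i ≡ Q zero + desBefore r i
    summed Q r h zero = sym (+-identityʳ (Q zero))
    summed {suc m} Q r h (suc i) = begin
      Q (suc i)                                          ≡⟨ summed (Q ∘ suc) (r ∘ suc) (h ∘ suc) i ⟩
      Q (suc zero) + desBefore (r ∘ suc) i               ≡⟨ cong (_+ desBefore (r ∘ suc) i) (h zero) ⟩
      Q zero + descent (r zero) (r (suc zero)) + desBefore (r ∘ suc) i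
                                                         ≡⟨ +-assoc (Q zero) _ _ ⟩
      Q zero + desBefore r (suc i)                       ∎
      where open ≡-Reasoning
    increments : (∀ i → Q i ≡ Q zero + desBefore r i) → Consecutive (λ i j → Q j ≡ Q i + descent (r i) (r j))
    increments h i = begin
      Q (suc i)                                          ≡⟨ h (suc i) ⟩
      Q zero + desBefore r (suc i)                       ≡⟨ cong (Q zero +_) (desBefore-step r i) ⟩
      Q zero + (desBefore r (inject₁ i) + d)             ≡⟨ +-assoc (Q zero) _ d ⟨
      Q zero + desBefore r (inject₁ i) + d               ≡⟨ cong (_+ d) (h (inject₁ i)) ⟨
      Q (inject₁ i) + d                                  ∎
      where
      open ≡-Reasoning
      d : ℕ
      d = descent (r (inject₁ i)) (r (suc i))

  Radix : ∀ {m} → (Fin (suc m) → ℕ) → Set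
  Radix S = Consecutive (λ i j → S i ≡ suc (S j))

  fracSteps⇔descents : ∀ {m} {S r Q : Fin (suc m) → ℕ} → Radix S → (∀ i → r i < S i) →
    Consecutive (λ i j → FracStep (Q i * S i + r i) (S i) (Q j * S j + r j) (S j)) ⇔
    (∀ i → Q i ≡ Q zero + desBefore r i)
  fracSteps⇔descents {S = S} {r} {Q} radix digit = mk⇔
    (λ steps → Equivalence.to (telescope Q r) (λ i → Equivalence.to (carry-at i) (steps i)))
    (λ hQ i → Equivalence.from (carry-at i) (Equivalence.from (telescope Q r) hQ i))
    where
    carry-at : ∀ i →
      FracStep (Q (inject₁ i) * S (inject₁ i) + r (inject₁ i)) (S (inject₁ i)) (Q (suc i) * S (suc i) + r (suc i)) (S (suc i))
      ⇔ (Q (suc i) ≡ Q (inject₁ i) + descent (r (inject₁ i)) (r (suc i)))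
    carry-at i = radix-step {Q = Q (inject₁ i)} {Q′ = Q (suc i)} (radix i) (digit (inject₁ i)) (digit (suc i))

module Quotients where

  open Carries using (Consecutive; FracStep)
  open import Data.Nat as ℕ using (ℕ; zero; suc)
  open import Data.Fin using (Fin; zero; suc; inject₁; _≤?_)
  open import Data.Fin.Properties using (toℕ-inject₁)
  import Data.Integer as ℤ
  open import Data.Rational using (ℚ; 0ℚ; 1ℚ; _+_; _*_; _-_; -_; _≤_; _<_; _/_; toℚᵘ; Positive)
  import Data.Rational.Properties as ℚ
  open import Data.Rational.Unnormalised using (mkℚᵘ; *≡*; *≤*; *<*; 1ℚᵘ) renaming (_≃_ to _≃ᵘ_; _≤_ to _≤ᵘ_; _<_ to _<ᵘ_; _+_ to _+ᵘ_; _*_ to _*ᵘ_)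
  import Data.Rational.Unnormalised.Properties as ℚᵘ
  import Data.Integer.Properties as ℤ
  import Data.Nat.Properties as ℕ
  open import Data.Integer.Tactic.RingSolver using (solve-∀)
  open import Data.Rational.Solver using (module +-*-Solver)
  open import Data.Product using (Σ; _×_; _,_; proj₁; proj₂)
  open import Relation.Nullary using (does; yes; no)
  open import Relation.Nullary.Decidable using (dec-true; dec-false)
  open import Relation.Binary.PropositionalEquality
  open import Function using (_∘_; _⇔_; mk⇔; Equivalence)
  open import Data.Bool using (if_then_else_)

  partialSum : ∀ {n} → (Fin n → ℚ) → Fin n → ℚ
  partialSum c zero    = c zero
  partialSum c (suc i) = c zero + partialSum (c ∘ suc) i

  partialSum-step : ∀ {m} (c : Fin (suc m) → ℚ) (i : Fin m) →
    partialSum c (suc i) ≡ partialSum c (inject₁ i) + c (suc i)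
  partialSum-step c zero = refl
  partialSum-step {suc m} c (suc i) = begin
    c zero + partialSum (c ∘ suc) (suc i)                   ≡⟨ cong (c zero +_) (partialSum-step (c ∘ suc) i) ⟩
    c zero + (partialSum (c ∘ suc) (inject₁ i) + c (suc (suc i))) ≡⟨ ℚ.+-assoc (c zero) _ _ ⟨
    c zero + partialSum (c ∘ suc) (inject₁ i) + c (suc (suc i))   ∎
    where open ≡-Reasoning

  sumℚ-cong : ∀ {n} {f g : Fin n → ℚ} → (∀ j → f j ≡ g j) → sumℚ f ≡ sumℚ g
  sumℚ-cong {zero}  h = refl
  sumℚ-cong {suc n} h = cong₂ _+_ (h zero) (sumℚ-cong (h ∘ suc))

  sumℚ-zero : ∀ {n} {f : Fin n → ℚ} → (∀ j → f j ≡ 0ℚ) → sumℚ f ≡ 0ℚ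
  sumℚ-zero {zero}  h = refl
  sumℚ-zero {suc n} h = cong₂ _+_ (h zero) (sumℚ-zero (h ∘ suc))

  s-suc : ∀ {n} (i : Fin n) → s (suc i) ≡ s i
  s-suc i = cong suc (toℕ-inject₁ _)

  w-suc : ∀ {n} (j i : Fin n) → w (suc j) (suc i) ≡ w j i
  w-suc j i with j ≤? i
  ... | yes j≤i = begin
    w (suc j) (suc i)  ≡⟨ cong (λ b → if b then s (suc i) else 0) (dec-true (suc j ≤? suc i) (ℕ.s≤s j≤i)) ⟩
    s (suc i)          ≡⟨ s-suc i ⟩
    s i                ≡⟨ cong (λ b → if b then s i else 0) (dec-true (j ≤? i) j≤i) ⟨
    w j i              ∎
    where open ≡-Reasoning
  ... | no j≰i = trans (cong (λ b → if b then s (suc i) else 0) (dec-false (suc j ≤? suc i) (j≰i ∘ ℕ.s≤s⁻¹)))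
                       (sym (cong (λ b → if b then s i else 0) (dec-false (j ≤? i) j≰i)))

  ⟦_⟧ : ℕ → ℚ
  ⟦ n ⟧ = toℚ (ℤ.+ n)

  -- Since w_j = (0,…,0,s_j,…,s_n), the i-th coordinate of Σ_j c_j w_j is C_i · s_i.
  sum-w : ∀ {n} (c : Fin n → ℚ) (i : Fin n) → sumℚ (λ j → c j * ⟦ w j i ⟧) ≡ partialSum c i * ⟦ s i ⟧
  sum-w {suc n} c zero = begin
    c zero * ⟦ s₀ ⟧ + sumℚ (λ j → c (suc j) * 0ℚ)  ≡⟨ cong (c zero * ⟦ s₀ ⟧ +_) (sumℚ-zero (λ j → ℚ.*-zeroʳ (c (suc j)))) ⟩
    c zero * ⟦ s₀ ⟧ + 0ℚ                           ≡⟨ ℚ.+-identityʳ _ ⟩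
    c zero * ⟦ s₀ ⟧                                ∎
    where
    open ≡-Reasoning
    s₀ : ℕ
    s₀ = s {suc n} zero
  sum-w {suc n} c (suc i) = begin
    c zero * ⟦ s (suc i) ⟧ + sumℚ (λ j → c (suc j) * ⟦ w (suc j) (suc i) ⟧)
      ≡⟨ cong (head +_) (sumℚ-cong (λ j → cong (λ t → c (suc j) * ⟦ t ⟧) (w-suc j i))) ⟩
    c zero * ⟦ s (suc i) ⟧ + sumℚ (λ j → c (suc j) * ⟦ w j i ⟧)
      ≡⟨ cong (head +_) (sum-w (c ∘ suc) i) ⟩
    c zero * ⟦ s (suc i) ⟧ + partialSum (c ∘ suc) i * ⟦ s i ⟧
      ≡⟨ cong (λ t → head + partialSum (c ∘ suc) i * ⟦ t ⟧) (s-suc i) ⟨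
    c zero * ⟦ s (suc i) ⟧ + partialSum (c ∘ suc) i * ⟦ s (suc i) ⟧
      ≡⟨ ℚ.*-distribʳ-+ ⟦ s (suc i) ⟧ (c zero) _ ⟨
    partialSum c (suc i) * ⟦ s (suc i) ⟧ ∎
    where
    open ≡-Reasoning
    head : ℚ
    head = c zero * ⟦ s (suc i) ⟧

  Step : ℚ → ℚ → Set
  Step u v = (u ≤ v) × (v < u + 1ℚ)

  step-by : ∀ u {c} → Step 0ℚ c → Step u (u + c)
  step-by u {c} (0≤c , c<1) = subst (_≤ u + c) (ℚ.+-identityʳ u) (ℚ.+-monoʳ-≤ u 0≤c) , ℚ.+-monoʳ-< u c<1

  step-difference : ∀ {u v} → Step u v → Step 0ℚ (v - u)
  step-difference {u} {v} (u≤v , v<u+1) =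
    subst (_≤ v - u) (ℚ.+-inverseʳ u) (ℚ.+-monoˡ-≤ (- u) u≤v) ,
    subst (v - u <_) (solve 1 (λ u → (u :+ con 1ℚ) :- u := con 1ℚ) refl u) (ℚ.+-monoˡ-< (- u) v<u+1)
    where open +-*-Solver

  StepsFrom : ∀ {m} → ℚ → (Fin (suc m) → ℚ) → Set
  StepsFrom a C = Step a (C zero) × Consecutive (λ i j → Step (C i) (C j))

  partialSum-steps : ∀ {m} (c : Fin (suc m) → ℚ) → (∀ j → Step 0ℚ (c j)) → StepsFrom 0ℚ (partialSum c)
  partialSum-steps c unit = unit zero , λ i → subst (Step _) (sym (partialSum-step c i)) (step-by _ (unit (suc i)))

  differences : ∀ {n} → ℚ → (Fin n → ℚ) → Fin n → ℚ
  differences a C zero    = C zero - a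
  differences a C (suc j) = differences (C zero) (C ∘ suc) j

  partialSum-differences : ∀ {n} a (C : Fin n → ℚ) i → partialSum (differences a C) i ≡ C i - a
  partialSum-differences a C zero = refl
  partialSum-differences a C (suc i) = begin
    (C zero - a) + partialSum (differences (C zero) (C ∘ suc)) i ≡⟨ cong ((C zero - a) +_) (partialSum-differences (C zero) (C ∘ suc) i) ⟩
    (C zero - a) + (C (suc i) - C zero)                         ≡⟨ solve 3 (λ x a y → (x :- a) :+ (y :- x) := y :- a) refl (C zero) a (C (suc i)) ⟩
    C (suc i) - a                                               ∎
    where
    open ≡-Reasoning
    open +-*-Solver

  differences-steps : ∀ {m} a (C : Fin (suc m) → ℚ) → StepsFrom a C → ∀ j → Step 0ℚ (differences a C j)
  differences-steps a C (first , _) zero = step-difference first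
  differences-steps {suc m} a C (_ , steps) (suc j) = differences-steps (C zero) (C ∘ suc) (steps zero , steps ∘ suc) j

  ScaledSteps : ∀ {m} → (Fin (suc m) → ℤ.ℤ) → Set
  ScaledSteps {m} x = Σ (Fin (suc m) → ℚ) λ C → StepsFrom 0ℚ C × (∀ i → toℚ (x i) ≡ C i * ⟦ s i ⟧)

  inPar⇔scaledSteps : ∀ {m} (x : Fin (suc m) → ℤ.ℤ) → InPar x ⇔ ScaledSteps x
  inPar⇔scaledSteps x = mk⇔
    (λ (c , unit , eq) → partialSum c , partialSum-steps c unit , λ i → trans (eq i) (sum-w c i))
    (λ (C , steps , eq) → differences 0ℚ C , differences-steps 0ℚ C steps , λ i → begin
      toℚ (x i)                                 ≡⟨ eq i ⟩
      C i * ⟦ s i ⟧                             ≡⟨ cong (_* ⟦ s i ⟧) (ℚ.+-identityʳ (C i)) ⟨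
      (C i - 0ℚ) * ⟦ s i ⟧                      ≡⟨ cong (_* ⟦ s i ⟧) (partialSum-differences 0ℚ C i) ⟨
      partialSum (differences 0ℚ C) i * ⟦ s i ⟧ ≡⟨ sum-w (differences 0ℚ C) i ⟨
      sumℚ (λ j → differences 0ℚ C j * ⟦ w j i ⟧) ∎)
    where open ≡-Reasoning

  frac : ℤ.ℤ → ℕ → ℚ
  frac z k = z / suc k

  toℚᵘ-frac : ∀ z k → toℚᵘ (frac z k) ≃ᵘ mkℚᵘ z k
  toℚᵘ-frac z k = ℚ.toℚᵘ-fromℚᵘ (mkℚᵘ z k)

  frac-≤ : ∀ {X a Y b} → frac (ℤ.+ X) a ≤ frac (ℤ.+ Y) b ⇔ X ℕ.* suc b ℕ.≤ Y ℕ.* suc a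
  frac-≤ {X} {a} {Y} {b} = mk⇔
    (λ h → cross (ℚᵘ.≤-respʳ-≃ (toℚᵘ-frac (ℤ.+ Y) b) (ℚᵘ.≤-respˡ-≃ (toℚᵘ-frac (ℤ.+ X) a) (ℚ.toℚᵘ-mono-≤ h))))
    (λ h → ℚ.toℚᵘ-cancel-≤ (ℚᵘ.≤-respʳ-≃ (ℚᵘ.≃-sym (toℚᵘ-frac (ℤ.+ Y) b)) (ℚᵘ.≤-respˡ-≃ (ℚᵘ.≃-sym (toℚᵘ-frac (ℤ.+ X) a))
       (*≤* (subst₂ ℤ._≤_ (ℤ.pos-* X (suc b)) (ℤ.pos-* Y (suc a)) (ℤ.+≤+ h))))))
    where
    cross : mkℚᵘ (ℤ.+ X) a ≤ᵘ mkℚᵘ (ℤ.+ Y) b → X ℕ.* suc b ℕ.≤ Y ℕ.* suc a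
    cross (*≤* g) = ℤ.drop‿+≤+ (subst₂ ℤ._≤_ (sym (ℤ.pos-* X (suc b))) (sym (ℤ.pos-* Y (suc a))) g)

  frac-< : ∀ {X a Y b} → frac (ℤ.+ X) a < frac (ℤ.+ Y) b ⇔ X ℕ.* suc b ℕ.< Y ℕ.* suc a
  frac-< {X} {a} {Y} {b} = mk⇔
    (λ h → cross (ℚᵘ.<-respʳ-≃ (toℚᵘ-frac (ℤ.+ Y) b) (ℚᵘ.<-respˡ-≃ (toℚᵘ-frac (ℤ.+ X) a) (ℚ.toℚᵘ-mono-< h))))
    (λ h → ℚ.toℚᵘ-cancel-< (ℚᵘ.<-respʳ-≃ (ℚᵘ.≃-sym (toℚᵘ-frac (ℤ.+ Y) b)) (ℚᵘ.<-respˡ-≃ (ℚᵘ.≃-sym (toℚᵘ-frac (ℤ.+ X) a))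
       (*<* (subst₂ ℤ._<_ (ℤ.pos-* X (suc b)) (ℤ.pos-* Y (suc a)) (ℤ.+<+ h))))))
    where
    cross : mkℚᵘ (ℤ.+ X) a <ᵘ mkℚᵘ (ℤ.+ Y) b → X ℕ.* suc b ℕ.< Y ℕ.* suc a
    cross (*<* g) = ℤ.drop‿+<+ (subst₂ ℤ._<_ (sym (ℤ.pos-* X (suc b))) (sym (ℤ.pos-* Y (suc a))) g)

  frac-+1 : ∀ X a → frac (ℤ.+ X) a + 1ℚ ≡ frac (ℤ.+ (X ℕ.+ suc a)) a
  frac-+1 X a = ℚ.toℚᵘ-injective (begin
    toℚᵘ (frac (ℤ.+ X) a + 1ℚ)          ≈⟨ ℚ.toℚᵘ-homo-+ (frac (ℤ.+ X) a) 1ℚ ⟩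
    toℚᵘ (frac (ℤ.+ X) a) +ᵘ 1ℚᵘ        ≈⟨ ℚᵘ.+-congˡ 1ℚᵘ (toℚᵘ-frac (ℤ.+ X) a) ⟩
    mkℚᵘ (ℤ.+ X) a +ᵘ 1ℚᵘ               ≈⟨ *≡* (trans (ring (ℤ.+ X) (ℤ.+ suc a)) (cong (ℤ.+ (X ℕ.+ suc a) ℤ.*_) (sym (ℤ.pos-* (suc a) 1)))) ⟩
    mkℚᵘ (ℤ.+ (X ℕ.+ suc a)) a          ≈⟨ toℚᵘ-frac (ℤ.+ (X ℕ.+ suc a)) a ⟨
    toℚᵘ (frac (ℤ.+ (X ℕ.+ suc a)) a)   ∎)
    where
    open ℚᵘ.≃-Reasoning
    ring : ∀ x d → (x ℤ.* ℤ.+ 1 ℤ.+ ℤ.+ 1 ℤ.* d) ℤ.* d ≡ (x ℤ.+ d) ℤ.* (d ℤ.* ℤ.+ 1)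
    ring = solve-∀

  frac-*-den : ∀ z k → frac z k * ⟦ suc k ⟧ ≡ toℚ z
  frac-*-den z k = ℚ.toℚᵘ-injective (begin
    toℚᵘ (frac z k * ⟦ suc k ⟧)          ≈⟨ ℚ.toℚᵘ-homo-* (frac z k) ⟦ suc k ⟧ ⟩
    toℚᵘ (frac z k) *ᵘ toℚᵘ ⟦ suc k ⟧    ≈⟨ ℚᵘ.*-cong (toℚᵘ-frac z k) (toℚᵘ-frac (ℤ.+ suc k) 0) ⟩
    mkℚᵘ z k *ᵘ mkℚᵘ (ℤ.+ suc k) 0       ≈⟨ *≡* (trans (ℤ.*-identityʳ _) (cong (λ n → z ℤ.* ℤ.+ suc n) (sym (ℕ.*-identityʳ k)))) ⟩
    mkℚᵘ z 0                             ≈⟨ toℚᵘ-frac z 0 ⟨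
    toℚᵘ (toℚ z)                         ∎)
    where open ℚᵘ.≃-Reasoning

  *-cancel-den : ∀ {C D} k → C * ⟦ suc k ⟧ ≡ D * ⟦ suc k ⟧ → C ≡ D
  *-cancel-den k e = ℚ.≤-antisym (ℚ.*-cancelʳ-≤-pos ⟦ suc k ⟧ (ℚ.≤-reflexive e)) (ℚ.*-cancelʳ-≤-pos ⟦ suc k ⟧ (ℚ.≤-reflexive (sym e)))
    where instance
    den-positive : Positive ⟦ suc k ⟧
    den-positive = ℚ.normalize-pos (suc k) 1

  nonneg-quotient : ∀ {z C} k → 0ℚ ≤ C → toℚ z ≡ C * ⟦ suc k ⟧ → Σ ℕ λ X → (z ≡ ℤ.+ X) × (C ≡ frac (ℤ.+ X) k)
  nonneg-quotient {z} {C} k 0≤C e = natural z (subst (0ℚ ≤_) C≡z/k 0≤C) C≡z/k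
    where
    C≡z/k : C ≡ frac z k
    C≡z/k = *-cancel-den k (trans (sym e) (sym (frac-*-den z k)))
    natural : ∀ z → 0ℚ ≤ frac z k → C ≡ frac z k → Σ ℕ λ X → (z ≡ ℤ.+ X) × (C ≡ frac (ℤ.+ X) k)
    natural (ℤ.+ X) _ C≡ = X , refl , C≡
    natural ℤ.-[1+ m ] 0≤z/k _ with ℚᵘ.≤-respʳ-≃ (toℚᵘ-frac ℤ.-[1+ m ] k) (ℚ.toℚᵘ-mono-≤ 0≤z/k)
    ... | *≤* ()

  step⇔fracStep : ∀ X a Y b → Step (frac (ℤ.+ X) a) (frac (ℤ.+ Y) b) ⇔ FracStep X (suc a) Y (suc b)
  step⇔fracStep X a Y b = mk⇔
    (λ (lower , upper) → Equivalence.to (frac-≤ {X} {a} {Y} {b}) lower ,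
                         Equivalence.to (frac-< {Y} {b} {X ℕ.+ suc a} {a}) (subst (frac (ℤ.+ Y) b <_) (frac-+1 X a) upper))
    (λ (lower , upper) → Equivalence.from (frac-≤ {X} {a} {Y} {b}) lower ,
                         subst (frac (ℤ.+ Y) b <_) (sym (frac-+1 X a)) (Equivalence.from (frac-< {Y} {b} {X ℕ.+ suc a} {a}) upper))

  first-step : ∀ X k → Step 0ℚ (frac (ℤ.+ X) k) ⇔ X ℕ.< suc k
  first-step X k = mk⇔
    (λ h → subst₂ ℕ._<_ (ℕ.*-identityʳ X) (ℕ.+-identityʳ (suc k)) (proj₂ (Equivalence.to (step⇔fracStep 0 0 X k) h)))
    (λ h → Equivalence.from (step⇔fracStep 0 0 X k) (ℕ.z≤n , subst₂ ℕ._<_ (sym (ℕ.*-identityʳ X)) (sym (ℕ.+-identityʳ (suc k))) h))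

  steps-above : ∀ {m} {a} (C : Fin (suc m) → ℚ) → StepsFrom a C → ∀ i → a ≤ C i
  steps-above C (first , _) zero = proj₁ first
  steps-above {suc m} C (first , steps) (suc i) = ℚ.≤-trans (proj₁ first) (steps-above (C ∘ suc) (steps zero , steps ∘ suc) i)

open Carries
open Quotients using (Step; frac; inPar⇔scaledSteps; step⇔fracStep; first-step; frac-*-den; nonneg-quotient; steps-above)
open import Data.Nat using (zero; suc; _+_; _*_; _∸_; _<_; _%_; _/_; NonZero)
open import Data.Nat.Properties using (+-comm; +-∸-assoc)
open import Data.Nat.DivMod using (m≡m%n+[m/n]*n; [m+kn]%n≡m%n; m<n⇒m%n≡m; m<n⇒m/n≡0)
open import Data.Fin using (zero; suc; toℕ; opposite; inject₁)
open import Data.Fin.Properties using (toℕ-inject₁; opposite-prop; toℕ<n)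
open import Data.Integer as ℤ using (+_)
open import Data.Integer.DivMod using (n%ℕd<d)
open import Data.Rational using (ℚ; 0ℚ)
open import Data.Product using (Σ; _,_; proj₁; proj₂)
open import Function using (Equivalence)
open import Relation.Binary.PropositionalEquality

s-radix : ∀ {m} → Radix (s {suc m})
s-radix {m} i = cong suc (begin
  toℕ (opposite (inject₁ i))    ≡⟨ opposite-prop (inject₁ i) ⟩
  m ∸ toℕ (inject₁ i)           ≡⟨ cong (m ∸_) (toℕ-inject₁ i) ⟩
  m ∸ toℕ i                     ≡⟨ +-∸-assoc 1 (toℕ<n i) ⟩
  suc (m ∸ suc (toℕ i))         ≡⟨ cong suc (opposite-prop (suc i)) ⟨
  suc (toℕ (opposite (suc i)))  ∎)
  where open ≡-Reasoning

s⁻ : ∀ {n} → Fin n → ℕ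
s⁻ i = toℕ (opposite i)

NatSteps : ∀ {m} → (Fin (suc m) → ℕ) → Set
NatSteps {m} X = (X zero < s {suc m} zero) × Consecutive (λ i j → FracStep (X i) (s i) (X j) (s j))

natSteps⇒inPar : ∀ {m} (X : Fin (suc m) → ℕ) → NatSteps X → InPar (λ i → + X i)
natSteps⇒inPar {m} X (X₀<s₀ , steps) = Equivalence.from (inPar⇔scaledSteps (λ i → + X i))
  (C , (Equivalence.from (first-step (X zero) (s⁻ zero)) X₀<s₀ ,
         λ i → Equivalence.from (step⇔fracStep (X (inject₁ i)) (s⁻ (inject₁ i)) (X (suc i)) (s⁻ (suc i))) (steps i)) ,
   λ i → sym (frac-*-den (+ X i) (s⁻ i)))
  where
  C : Fin (suc m) → ℚ
  C i = frac (+ X i) (s⁻ i)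

inPar⇒natSteps : ∀ {m} (x : Fin (suc m) → ℤ) → InPar x → Σ (Fin (suc m) → ℕ) λ X → (∀ i → x i ≡ + X i) × NatSteps X
inPar⇒natSteps {m} x par with Equivalence.to (inPar⇔scaledSteps x) par
... | C , C-steps@(first , steps) , x≡Cs = X , x≡X ,
      Equivalence.to (first-step (X zero) (s⁻ zero)) (subst (Step 0ℚ) (C≡ zero) first) ,
      λ i → Equivalence.to (step⇔fracStep (X (inject₁ i)) (s⁻ (inject₁ i)) (X (suc i)) (s⁻ (suc i)))
              (subst₂ Step (C≡ (inject₁ i)) (C≡ (suc i)) (steps i))
  where
  quotient : ∀ i → Σ ℕ λ Xᵢ → (x i ≡ + Xᵢ) × (C i ≡ frac (+ Xᵢ) (s⁻ i))
  quotient i = nonneg-quotient (s⁻ i) (steps-above C C-steps i) (x≡Cs i)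
  X : Fin (suc m) → ℕ
  X i = proj₁ (quotient i)
  x≡X : ∀ i → x i ≡ + X i
  x≡X i = proj₁ (proj₂ (quotient i))
  C≡ : ∀ i → C i ≡ frac (+ X i) (s⁻ i)
  C≡ i = proj₂ (proj₂ (quotient i))

remainder : ∀ {d} .{{_ : NonZero d}} q r → r < d → (q * d + r) % d ≡ r
remainder {d} q r r<d = trans (cong (_% d) (+-comm (q * d) r)) (trans ([m+kn]%n≡m%n r q d) (m<n⇒m%n≡m r<d))

invREM-inPar : ∀ {m} (r : Fin (suc m) → ℕ) → IsInvSeq r → InPar (invREM r)
invREM-inPar r r<s = natSteps⇒inPar (λ i → desBefore r i * s i + r i)
  (r<s zero , Equivalence.from (fracSteps⇔descents {Q = desBefore r} s-radix r<s) (λ i → refl))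

REM-invREM : ∀ {n} (r : Fin n → ℕ) → IsInvSeq r → ∀ i → REM (invREM r) i ≡ r i
REM-invREM r r<s i = remainder (desBefore r i) (r i) (r<s i)

-- If x = (X_i) satisfies the step conditions, its quotients x_i / s_i are
-- forced to be des^{<i}(REM x), so x is recovered from REM x.
invREM-REM : ∀ {m} (x : Fin (suc m) → ℤ) (X : Fin (suc m) → ℕ) →
  (∀ i → x i ≡ + X i) → NatSteps X → ∀ i → invREM (REM x) i ≡ x i
invREM-REM {m} x X x≡X (X₀<s₀ , steps) i = begin
  + (desBefore (REM x) i * s i + REM x i) ≡⟨ cong (λ q → + (q * s i + REM x i)) Qᵢ≡des ⟨
  + (Q i * s i + REM x i)                 ≡⟨ cong +_ (decomposition i) ⟨
  + X i                                   ≡⟨ x≡X i ⟨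
  x i                                     ∎
  where
  open ≡-Reasoning
  Q : Fin (suc m) → ℕ
  Q j = X j / s j
  decomposition : ∀ j → X j ≡ Q j * s j + REM x j
  decomposition j = trans (m≡m%n+[m/n]*n (X j) (s j))
    (trans (+-comm (X j % s j) (Q j * s j)) (cong (λ ρ → Q j * s j + ρ) (sym (cong (ℤ._%ℕ s j) (x≡X j)))))
  quotients : ∀ j → Q j ≡ Q zero + desBefore (REM x) j
  quotients = Equivalence.to (fracSteps⇔descents {S = s} {REM x} {Q} s-radix (λ j → n%ℕd<d (x j) (s j)))
    (λ j → subst₂ (λ A B → FracStep A (s (inject₁ j)) B (s (suc j))) (decomposition (inject₁ j)) (decomposition (suc j)) (steps j))
  Qᵢ≡des : Q i ≡ desBefore (REM x) i
  Qᵢ≡des = trans (quotients i) (cong (_+ desBefore (REM x) i) (m<n⇒m/n≡0 X₀<s₀))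

corollary4p3 : (n : ℕ) →
    ((x : Fin n → ℤ) → InPar x → IsInvSeq (REM x)) ×
    ((r : Fin n → ℕ) → IsInvSeq r → InPar (invREM r) × ((i : Fin n) → REM (invREM r) i ≡ r i)) ×
    ((x : Fin n → ℤ) → InPar x → (i : Fin n) → invREM (REM x) i ≡ x i)
corollary4p3 zero = (λ _ _ ()) , (λ _ _ → ((λ ()) , (λ ()) , (λ ())) , λ ()) , λ _ _ ()
corollary4p3 (suc m) =
  (λ x _ i → n%ℕd<d (x i) (s i)) ,
  (λ r r<s → invREM-inPar r r<s , REM-invREM r r<s) ,
  (λ x par → let (X , x≡X , natSteps) = inPar⇒natSteps x par in invREM-REM x X x≡X natSteps)
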